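{- Let $G$ be a group, let $s$ be a central involution of $G$, and let $(\Gamma,\psi)$ be a $G$-gain graph whose underlying graph $\Gamma$ is finite, simple, connected and has at least one edge. Then $\psi\sim\mathbf{s}$ if and only if $\psi(W)=s^{|W|}$ for every closed walk $W$ of $\Gamma$.
   Context: A gain function on a simple graph $\Gamma$ over a group $G$ is a map $\psi$ from the set of ordered pairs $(u,v)$ of adjacent vertices of $\Gamma$ to $G$ such that $\psi(v,u)=\psi(u,v)^{ -1}$; $(\Gamma,\psi)$ is then called a $G$-gain graph. For a walk $W=v_0,v_1,\dots,v_\ell$ (consecutive vertices adjacent), $|W|=\ell$ is its length and its gain is $\psi(W)=\psi(v_0,v_1)\psi(v_1,v_2)\cdots\psi(v_{\ell-1},v_\ell)$; $W$ is closed if $v_0=v_\ell$. Two gain functions $\psi_1,\psi_2$ on $\Gamma$ are switching equivalent, written $\psi_1\sim\psi_2$, if there is $f\colon V_\Gamma\to G$ with $\psi_2(u,v)=f(u)^{ -1}\psi_1(u,v)f(v)$ for all adjacent $u,v$. An involution is an element $s$ with $s^2=1_G$; it is central if it commutes with every element of $G$. For such $s$, $\mathbf{s}$ denotes the gain function with $\mathbf{s}(u,v)=s$ for all adjacent $u,v$. -}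

module Defs where

open import Level using (Level; _⊔_)
open import Data.Nat using (ℕ; zero; suc)
open import Data.Fin using (Fin)
open import Data.Bool using (Bool; true; false; T)
open import Data.Product using (Σ; ∃; _×_)
open import Relation.Binary.PropositionalEquality using (_≡_)
open import Algebra.Bundles using (Group)

record SimpleGraph (n : ℕ) : Set where
  field
    adj    : Fin n → Fin n → Bool
    sym    : ∀ u v → adj u v ≡ adj v u
    irrefl : ∀ u → adj u u ≡ false

module _ {n : ℕ} (Γ : SimpleGraph n) where
  open SimpleGraph Γ

  Adj : Fin n → Fin n → Set
  Adj u v = T (adj u v)

  data Walk : Fin n → Fin n → Set where
    []  : ∀ {v} → Walk v v
    _∷_ : ∀ {u w v} → Adj u w → Walk w v → Walk u v

  length : ∀ {u v} → Walk u v → ℕ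
  length []      = 0
  length (_ ∷ W) = suc (length W)

  Connected : Set
  Connected = ∀ u v → Walk u v

  HasEdge : Set
  HasEdge = Σ (Fin n) λ u → Σ (Fin n) λ v → Adj u v

  module _ {c ℓ : Level} (G : Group c ℓ) where
    open Group G

    EdgeMap : Set c
    EdgeMap = ∀ u v → Adj u v → Carrier

    IsGainFunction : EdgeMap → Set ℓ
    IsGainFunction ψ = ∀ u v (e : Adj u v) (e′ : Adj v u) → ψ v u e′ ≈ ψ u v e ⁻¹

    gain : EdgeMap → ∀ {u v} → Walk u v → Carrier
    gain ψ []                = ε
    gain ψ (_∷_ {u} {w} e W) = ψ u w e ∙ gain ψ W

    SwitchingEquivalent : EdgeMap → EdgeMap → Set (c ⊔ ℓ)
    SwitchingEquivalent ψ₁ ψ₂ =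
      Σ (Fin n → Carrier) λ f → ∀ u v (e : Adj u v) → ψ₂ u v e ≈ (f u ⁻¹ ∙ ψ₁ u v e) ∙ f v

    constGain : Carrier → EdgeMap
    constGain s _ _ _ = s

module _ {c ℓ : Level} (G : Group c ℓ) where
  open Group G

  pow : Carrier → ℕ → Carrier
  pow g zero    = ε
  pow g (suc k) = g ∙ pow g k

  IsInvolution : Carrier → Set ℓ
  IsInvolution s = s ∙ s ≈ ε

  IsCentral : Carrier → Set (c ⊔ ℓ)
  IsCentral s = ∀ g → s ∙ g ≈ g ∙ s

module Submission where

-- Switching by f changes the gain of a u–v walk W to f(u)⁻¹ ψ(W) f(v), and
-- the gain of W under 𝐬 is s^|W|; for a closed walk at v the conjugation
-- by f(v) is invisible because s^|W| is central. Conversely, fix a root r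
-- and walks P_v from r to v, and switch by f(v) = ψ(P_v)⁻¹ s^|P_v|. For an
-- edge e = uv the closed walk P_u e P_v⁻¹ has gain s^(|P_u| + 1 + |P_v|),
-- which, since the powers of s are central involutions, says exactly that
-- the switched gain of e is s.

open import Defs
open import Level using (Level)
open import Data.Nat using (ℕ; zero; suc; _+_)
open import Data.Nat.Properties using (+-comm)
open import Data.Fin using (Fin)
open import Data.Bool using (T)
open import Data.Product using (_,_)
open import Algebra.Bundles using (Group)
open import Function.Bundles using (_⇔_; mk⇔)
open import Relation.Binary.PropositionalEquality as ≡ using (_≡_)
import Algebra.Properties.Group as GroupProperties
import Algebra.Properties.Monoid as MonoidProperties
import Relation.Binary.Reasoning.Setoid as SetoidReasoning

module WalkOperations {n : ℕ} (Γ : SimpleGraph n) where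

  Adj-sym : ∀ {u v} → Adj Γ u v → Adj Γ v u
  Adj-sym {u} {v} = ≡.subst T (SimpleGraph.sym Γ u v)

  infixr 5 _++_

  _++_ : ∀ {u w v} → Walk Γ u w → Walk Γ w v → Walk Γ u v
  []      ++ W′ = W′
  (e ∷ W) ++ W′ = e ∷ (W ++ W′)

  reverse : ∀ {u v} → Walk Γ u v → Walk Γ v u
  reverse []      = []
  reverse (e ∷ W) = reverse W ++ (Adj-sym e ∷ [])

  length-++ : ∀ {u w v} (W : Walk Γ u w) (W′ : Walk Γ w v) →
              length Γ (W ++ W′) ≡ length Γ W + length Γ W′
  length-++ []      W′ = ≡.refl
  length-++ (e ∷ W) W′ = ≡.cong suc (length-++ W W′)

  length-reverse : ∀ {u v} (W : Walk Γ u v) → length Γ (reverse W) ≡ length Γ W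
  length-reverse []      = ≡.refl
  length-reverse (e ∷ W) = ≡.trans (length-++ (reverse W) _)
    (≡.trans (≡.cong (_+ 1) (length-reverse W)) (+-comm (length Γ W) 1))

module CentralElements {c ℓ : Level} (G : Group c ℓ) where
  open Group G
  open GroupProperties G
  open MonoidProperties monoid using (uv≈w⇒xu∙vy≈x∙wy)
  open SetoidReasoning setoid

  ε-central : IsCentral G ε
  ε-central g = trans (identityˡ g) (sym (identityʳ g))

  ∙-central : ∀ {a b} → IsCentral G a → IsCentral G b → IsCentral G (a ∙ b)
  ∙-central {a} {b} ca cb g = begin
    (a ∙ b) ∙ g  ≈⟨ assoc a b g ⟩
    a ∙ (b ∙ g)  ≈⟨ ∙-congˡ (cb g) ⟩
    a ∙ (g ∙ b)  ≈⟨ assoc a g b ⟨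
    (a ∙ g) ∙ b  ≈⟨ ∙-congʳ (ca g) ⟩
    (g ∙ a) ∙ b  ≈⟨ assoc g a b ⟩
    g ∙ (a ∙ b)  ∎

  ∙-involution : ∀ {a b} → IsCentral G a → IsInvolution G a → IsInvolution G b →
                 IsInvolution G (a ∙ b)
  ∙-involution {a} {b} ca ia ib = begin
    (a ∙ b) ∙ (a ∙ b)  ≈⟨ ∙-congˡ (ca b) ⟩
    (a ∙ b) ∙ (b ∙ a)  ≈⟨ uv≈w⇒xu∙vy≈x∙wy ib a a ⟩
    a ∙ (ε ∙ a)        ≈⟨ ∙-congˡ (identityˡ a) ⟩
    a ∙ a              ≈⟨ ia ⟩
    ε                  ∎

  pow-+ : ∀ g m n → pow G g (m + n) ≈ pow G g m ∙ pow G g n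
  pow-+ g zero    n = sym (identityˡ (pow G g n))
  pow-+ g (suc m) n = trans (∙-congˡ (pow-+ g m n)) (sym (assoc g _ _))

  pow-central : ∀ {s} → IsCentral G s → ∀ k → IsCentral G (pow G s k)
  pow-central cs zero    = ε-central
  pow-central cs (suc k) = ∙-central cs (pow-central cs k)

  pow-involution : ∀ {s} → IsCentral G s → IsInvolution G s →
                   ∀ k → IsInvolution G (pow G s k)
  pow-involution cs is zero    = identityˡ ε
  pow-involution cs is (suc k) = ∙-involution cs is (pow-involution cs is k)

  central-conjugate : ∀ {t} → IsCentral G t → ∀ x → (x ⁻¹ ∙ t) ∙ x ≈ t
  central-conjugate {t} ct x = trans (∙-congʳ (sym (ct (x ⁻¹)))) (//-rightDividesˡ x t)

module Gains {c ℓ : Level} (G : Group c ℓ) {n : ℕ} (Γ : SimpleGraph n) where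
  open Group G
  open GroupProperties G
  open MonoidProperties monoid using (cancelᶜ; [u∙vw]x≈uv∙wx)
  open SetoidReasoning setoid
  open WalkOperations Γ

  gain-++ : (ψ : EdgeMap Γ G) → ∀ {u w v} (W : Walk Γ u w) (W′ : Walk Γ w v) →
            gain Γ G ψ (W ++ W′) ≈ gain Γ G ψ W ∙ gain Γ G ψ W′
  gain-++ ψ []      W′ = sym (identityˡ _)
  gain-++ ψ (e ∷ W) W′ = trans (∙-congˡ (gain-++ ψ W W′)) (sym (assoc _ _ _))

  gain-reverse : (ψ : EdgeMap Γ G) → IsGainFunction Γ G ψ →
                 ∀ {u v} (W : Walk Γ u v) → gain Γ G ψ (reverse W) ≈ gain Γ G ψ W ⁻¹
  gain-reverse ψ gf []                = sym ε⁻¹≈ε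
  gain-reverse ψ gf (_∷_ {u} {w} e W) = begin
    gain Γ G ψ (reverse W ++ (Adj-sym e ∷ []))   ≈⟨ gain-++ ψ (reverse W) _ ⟩
    gain Γ G ψ (reverse W) ∙ (ψ w u (Adj-sym e) ∙ ε)
      ≈⟨ ∙-cong (gain-reverse ψ gf W) (identityʳ _) ⟩
    gain Γ G ψ W ⁻¹ ∙ ψ w u (Adj-sym e)          ≈⟨ ∙-congˡ (gf u w e (Adj-sym e)) ⟩
    gain Γ G ψ W ⁻¹ ∙ ψ u w e ⁻¹                 ≈⟨ ⁻¹-anti-homo-∙ _ _ ⟨
    (ψ u w e ∙ gain Γ G ψ W) ⁻¹                  ∎

  gain-constGain : ∀ s {u v} (W : Walk Γ u v) →
                   gain Γ G (constGain Γ G s) W ≡ pow G s (length Γ W)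
  gain-constGain s []      = ≡.refl
  gain-constGain s (e ∷ W) = ≡.cong (s ∙_) (gain-constGain s W)

  gain-switch : (ψ₁ ψ₂ : EdgeMap Γ G) (f : Fin n → Carrier) →
                (∀ u v (e : Adj Γ u v) → ψ₂ u v e ≈ (f u ⁻¹ ∙ ψ₁ u v e) ∙ f v) →
                ∀ {u v} (W : Walk Γ u v) →
                gain Γ G ψ₂ W ≈ (f u ⁻¹ ∙ gain Γ G ψ₁ W) ∙ f v
  gain-switch ψ₁ ψ₂ f h {u} [] =
    sym (trans (∙-congʳ (identityʳ (f u ⁻¹))) (inverseˡ (f u)))
  gain-switch ψ₁ ψ₂ f h (_∷_ {u} {w} {v} e W) = begin
    ψ₂ u w e ∙ gain Γ G ψ₂ W
      ≈⟨ ∙-cong (h u w e) (gain-switch ψ₁ ψ₂ f h W) ⟩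
    ((f u ⁻¹ ∙ ψ₁ u w e) ∙ f w) ∙ ((f w ⁻¹ ∙ gain Γ G ψ₁ W) ∙ f v)
      ≈⟨ ∙-congˡ (assoc _ _ _) ⟩
    ((f u ⁻¹ ∙ ψ₁ u w e) ∙ f w) ∙ (f w ⁻¹ ∙ (gain Γ G ψ₁ W ∙ f v))
      ≈⟨ cancelᶜ (inverseʳ (f w)) _ _ ⟩
    (f u ⁻¹ ∙ ψ₁ u w e) ∙ (gain Γ G ψ₁ W ∙ f v)
      ≈⟨ [u∙vw]x≈uv∙wx _ _ _ _ ⟨
    (f u ⁻¹ ∙ (ψ₁ u w e ∙ gain Γ G ψ₁ W)) ∙ f v ∎

module _ {c ℓ : Level} (G : Group c ℓ) (s : Group.Carrier G) {n : ℕ} (Γ : SimpleGraph n)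
         (ψ : EdgeMap Γ G) where
  open Group G
  open GroupProperties G
  open MonoidProperties monoid using (cancelʳ; [uv∙w]x≈u[vw∙x]; [u∙vw]x≈uv∙wx)
  open SetoidReasoning setoid
  open CentralElements G
  open WalkOperations Γ
  open Gains G Γ

  ClosedWalkGainsArePowers : Set ℓ
  ClosedWalkGainsArePowers = ∀ (v : Fin n) (W : Walk Γ v v) → gain Γ G ψ W ≈ pow G s (length Γ W)

  switching⇒closedWalkGains : IsCentral G s → SwitchingEquivalent Γ G ψ (constGain Γ G s) →
                              ClosedWalkGainsArePowers
  switching⇒closedWalkGains cs (f , h) v W =
    ∙-cancelˡ (f v ⁻¹) _ _ (∙-cancelʳ (f v) _ _ (begin
      (f v ⁻¹ ∙ gain Γ G ψ W) ∙ f v   ≈⟨ gain-switch ψ (constGain Γ G s) f h W ⟨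
      gain Γ G (constGain Γ G s) W    ≡⟨ gain-constGain s W ⟩
      pow G s k                       ≈⟨ central-conjugate (pow-central cs k) (f v) ⟨
      (f v ⁻¹ ∙ pow G s k) ∙ f v      ∎))
    where k = length Γ W

  closedWalkGains⇒switching : IsInvolution G s → IsCentral G s → IsGainFunction Γ G ψ →
                              Fin n → Connected Γ → ClosedWalkGainsArePowers →
                              SwitchingEquivalent Γ G ψ (constGain Γ G s)
  closedWalkGains⇒switching is cs gf r connected closed = f , switched
    where
    P : ∀ v → Walk Γ r v
    P = connected r

    k : Fin n → ℕ
    k v = length Γ (P v)

    g : Fin n → Carrier
    g v = gain Γ G ψ (P v)

    S : Fin n → Carrier
    S v = pow G s (k v)

    f : Fin n → Carrier
    f v = g v ⁻¹ ∙ S v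

    detour : ∀ u v (e : Adj Γ u v) → g u ∙ (ψ u v e ∙ g v ⁻¹) ≈ S u ∙ (s ∙ S v)
    detour u v e = begin
      g u ∙ (ψ u v e ∙ g v ⁻¹)   ≈⟨ ∙-congˡ (∙-congˡ (gain-reverse ψ gf (P v))) ⟨
      g u ∙ gain Γ G ψ C         ≈⟨ gain-++ ψ (P u) _ ⟨
      gain Γ G ψ (P u ++ C)      ≈⟨ closed r (P u ++ C) ⟩
      pow G s (length Γ (P u ++ C))
        ≡⟨ ≡.cong (pow G s) (≡.trans (length-++ (P u) C)
                                     (≡.cong (λ m → k u + suc m) (length-reverse (P v)))) ⟩
      pow G s (k u + suc (k v))  ≈⟨ pow-+ s (k u) (suc (k v)) ⟩
      S u ∙ (s ∙ S v)            ∎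
      where
      C : Walk Γ u r
      C = e ∷ reverse (P v)

    switched : ∀ u v (e : Adj Γ u v) → s ≈ (f u ⁻¹ ∙ ψ u v e) ∙ f v
    switched u v e = sym (begin
      ((g u ⁻¹ ∙ S u) ⁻¹ ∙ ψ u v e) ∙ (g v ⁻¹ ∙ S v)
        ≈⟨ ∙-congʳ (∙-congʳ (trans (⁻¹-anti-homo-∙ _ _) (∙-congˡ (⁻¹-involutive _)))) ⟩
      ((S u ⁻¹ ∙ g u) ∙ ψ u v e) ∙ (g v ⁻¹ ∙ S v)
        ≈⟨ [uv∙w]x≈u[vw∙x] _ _ _ _ ⟩
      S u ⁻¹ ∙ ((g u ∙ ψ u v e) ∙ (g v ⁻¹ ∙ S v))
        ≈⟨ ∙-congˡ ([u∙vw]x≈uv∙wx _ _ _ _) ⟨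
      S u ⁻¹ ∙ ((g u ∙ (ψ u v e ∙ g v ⁻¹)) ∙ S v)
        ≈⟨ ∙-congˡ (∙-congʳ (detour u v e)) ⟩
      S u ⁻¹ ∙ ((S u ∙ (s ∙ S v)) ∙ S v)
        ≈⟨ ∙-congˡ (assoc _ _ _) ⟩
      S u ⁻¹ ∙ (S u ∙ ((s ∙ S v) ∙ S v))
        ≈⟨ \\-leftDividesʳ (S u) _ ⟩
      (s ∙ S v) ∙ S v
        ≈⟨ cancelʳ (pow-involution cs is (k v)) s ⟩
      s ∎)

lemma2p5 : {c ℓ : Level} (G : Group c ℓ) (s : Group.Carrier G) →
    IsInvolution G s → IsCentral G s →
    {n : ℕ} (Γ : SimpleGraph n) → Connected Γ → HasEdge Γ →
    (ψ : EdgeMap Γ G) → IsGainFunction Γ G ψ →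
    SwitchingEquivalent Γ G ψ (constGain Γ G s)
      ⇔ (∀ (v : Fin n) (W : Walk Γ v v) → Group._≈_ G (gain Γ G ψ W) (pow G s (length Γ W)))
lemma2p5 G s is cs Γ connected (r , _) ψ gf =
  mk⇔ (switching⇒closedWalkGains G s Γ ψ cs)
      (closedWalkGains⇒switching G s Γ ψ is cs gf r connected)
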